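{- Let $p$ be a prime, let $U\subseteq\mathbb F_p^2$ be nonempty, let $n$ be a positive integer with $np\geq\#U$, and let $m\in\mathbb F_p$. If $m$ is not a $U$-rich direction, then $H_{U,n}(x,m)=(x^p-x)^n$ in $\mathbb F_p[x]$.
   Context: A line of $\mathbb F_p^2$ is either $\ell_{m,k}=\{(u,v): v=mu-k\}$ with $m,k\in\mathbb F_p$ (slope $m$) or a vertical set $\{(u,v):u=c\}$ (slope $\infty$). For $U\subseteq\mathbb F_p^2$ put $\theta=\#U/p$; a line $\ell$ is $U$-rich if $\#(\ell\cap U)\geq\theta+1$, and a direction is $U$-rich if some line with that slope is $U$-rich. The Rédei polynomial is $R_U(x,y)=\prod_{(a,b)\in U}(x-ay+b)\in\mathbb F_p[x,y]$; it is monic in $x$ of degree $\#U$. For $n$ with $np\geq\#U$, let $S_{U,n}(x,y)$ and $T_{U,n}(x,y)$ be the quotient and remainder of the long division of $(x^p-x)^n$ by $R_U$ in $(\mathbb F_p[y])[x]$, i.e. $(x^p-x)^n=R_US_{U,n}+T_{U,n}$ with $\deg_xT_{U,n}<\#U$. The Rédei–Szőnyi polynomial is $H_{U,n}(x,y):=R_U(x,y)S_{U,n}(x,y)$. -}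

module Defs where

open import Data.Nat using (ℕ; zero; suc; _+_; _*_; _∸_; _≤_; NonZero)
open import Data.Nat.DivMod using (_mod_)
open import Data.Fin using (Fin; toℕ)
import Data.Fin as F
open import Data.List using (List; []; _∷_; map; foldr; length; filter; replicate; _++_)
open import Data.Product using (_×_; _,_; proj₁; proj₂; Σ)
open import Relation.Binary.PropositionalEquality using (_≡_)

-- Everything is relative to a modulus p (a prime in the theorem);
-- 𝔽ₚ is Fin p with arithmetic modulo p.
module _ (p : ℕ) {{_ : NonZero p}} where

  Fp : Set
  Fp = Fin p

  0F 1F : Fp
  0F = 0 mod p
  1F = 1 mod p

  infixl 6 _+F_
  infixl 7 _*F_
  _+F_ _*F_ : Fp → Fp → Fp
  a +F b = (toℕ a + toℕ b) mod p
  a *F b = (toℕ a * toℕ b) mod p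

  -F_ : Fp → Fp
  -F a = (p ∸ toℕ a) mod p

  -- Univariate polynomials 𝔽ₚ[t]: coefficient lists, lowest degree first.
  Poly1 : Set
  Poly1 = List Fp

  coeff1 : Poly1 → ℕ → Fp
  coeff1 []      _       = 0F
  coeff1 (a ∷ f) zero    = a
  coeff1 (a ∷ f) (suc i) = coeff1 f i

  _≈1_ : Poly1 → Poly1 → Set
  f ≈1 g = ∀ i → coeff1 f i ≡ coeff1 g i

  add1 : Poly1 → Poly1 → Poly1
  add1 []      g       = g
  add1 (a ∷ f) []      = a ∷ f
  add1 (a ∷ f) (b ∷ g) = (a +F b) ∷ add1 f g

  neg1 : Poly1 → Poly1
  neg1 = map -F_

  mul1 : Poly1 → Poly1 → Poly1
  mul1 []      g = []
  mul1 (a ∷ f) g = add1 (map (a *F_) g) (0F ∷ mul1 f g)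

  one1 : Poly1
  one1 = 1F ∷ []

  pow1 : Poly1 → ℕ → Poly1
  pow1 f zero    = one1
  pow1 f (suc n) = mul1 f (pow1 f n)

  mon1 : ℕ → Poly1
  mon1 k = replicate k 0F ++ (1F ∷ [])

  eval1 : Fp → Poly1 → Fp
  eval1 c []      = 0F
  eval1 c (a ∷ f) = a +F c *F eval1 c f

  xpx : Poly1
  xpx = add1 (mon1 p) (neg1 (mon1 1))

  -- Bivariate polynomials as elements of (𝔽ₚ[y])[x]:
  -- the i-th entry is the coefficient of x^i, a polynomial in y.
  Poly2 : Set
  Poly2 = List Poly1

  coeff2 : Poly2 → ℕ → Poly1
  coeff2 []      _       = []
  coeff2 (a ∷ f) zero    = a
  coeff2 (a ∷ f) (suc i) = coeff2 f i

  _≈2_ : Poly2 → Poly2 → Set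
  f ≈2 g = ∀ i → coeff2 f i ≈1 coeff2 g i

  add2 : Poly2 → Poly2 → Poly2
  add2 []      g       = g
  add2 (a ∷ f) []      = a ∷ f
  add2 (a ∷ f) (b ∷ g) = add1 a b ∷ add2 f g

  mul2 : Poly2 → Poly2 → Poly2
  mul2 []      g = []
  mul2 (a ∷ f) g = add2 (map (mul1 a) g) ([] ∷ mul2 f g)

  one2 : Poly2
  one2 = one1 ∷ []

  pow2 : Poly2 → ℕ → Poly2
  pow2 f zero    = one2
  pow2 f (suc n) = mul2 f (pow2 f n)

  constY : Poly1 → Poly2
  constY = map (λ c → c ∷ [])

  degX< : Poly2 → ℕ → Set
  degX< f d = ∀ i → d ≤ i → coeff2 f i ≈1 []

  evalY : Fp → Poly2 → Poly1
  evalY m = map (eval1 m)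

  -- Point sets U ⊆ 𝔽ₚ² are duplicate-free lists; #U = length U.

  -- the factor x - a y + b  (x-coefficients: b - a y, then 1)
  redeiFactor : Fp × Fp → Poly2
  redeiFactor (a , b) = (b ∷ -F a ∷ []) ∷ one1 ∷ []

  Redei : List (Fp × Fp) → Poly2
  Redei U = foldr (λ ab acc → mul2 (redeiFactor ab) acc) one2 U

  XpXpow2 : ℕ → Poly2
  XpXpow2 n = pow2 (constY xpx) n

  lineCount : Fp → Fp → List (Fp × Fp) → ℕ
  lineCount m k U = length (filter (λ uv → proj₂ uv F.≟ (m *F proj₁ uv +F -F k)) U)

  -- ℓ_{m,k} is U-rich: #(ℓ ∩ U) ≥ θ + 1 with θ = #U/p,
  -- i.e. (multiplying by p > 0) #U + p ≤ p · #(ℓ ∩ U)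
  RichLine : Fp → Fp → List (Fp × Fp) → Set
  RichLine m k U = length U + p ≤ p * lineCount m k U

  RichDirection : List (Fp × Fp) → Fp → Set
  RichDirection U m = Σ Fp (λ k → RichLine m k U)

module Submission where

-- Specialise y := m and write r, s, t for R_U(x, m), S(x, m), T(x, m), so that (x^p − x)^n = r s + t
-- with deg t < #U.  Each (a, b) ∈ U contributes the factor x − (m a − b) to r, so c ∈ 𝔽ₚ is a root of r
-- of multiplicity #(ℓ_{m,c} ∩ U), which is at most n because m is not U-rich and #U ≤ n p.  By Fermat,
-- every c is a root of (x^p − x)^n of multiplicity at least n.  Hence t vanishes at each c to at least
-- the multiplicity of c as a root of r; these multiplicities add up to #U > deg t, so t = 0.

open import Algebra.Bundles using (CommutativeRing)
open import Algebra.Structures using (IsCommutativeRing)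
open import Data.Empty using (⊥-elim)
open import Data.Fin as Fin using (Fin; toℕ; _≟_; inject₁)
open import Data.Fin.Properties using (toℕ-injective; toℕ-fromℕ<; toℕ<n; toℕ-fromℕ; toℕ-inject₁)
open import Data.List using (List; []; _∷_; map; drop; filter; length)
open import Data.List.Properties using (filter-accept; filter-reject; length-map)
open import Data.Nat as ℕ using (ℕ; zero; suc; NonZero; _!)
import Data.Nat.Properties as ℕ
open import Data.Nat.Combinatorics using (_C_; nCk≡n!/k![n-k]!; k![n∸k]!∣n!; nCn≡1)
open import Data.Nat.DivMod using (_/_; _%_; _mod_; m/n*n≡m; m%n<n; m<n⇒m%n≡m; n%n≡0; %-distribˡ-+; %-distribˡ-*)
open import Data.Nat.Divisibility using (_∣_; m%n≡0⇒n∣m; n∣m⇒m%n≡0; ∣1⇒≡1; ∣⇒≤; m∣m*n)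
open import Data.Nat.Primality using (Prime; euclidsLemma; prime⇒nonTrivial; prime⇒nonZero)
open import Data.Product using (_,_; proj₁; proj₂)
open import Data.Sum as Sum using (_⊎_; inj₁; inj₂)
open import Data.Vec.Functional using (tail; init; last)
open import Function using (_∘_)
open import Relation.Binary.Bundles using (Setoid)
open import Relation.Binary.PropositionalEquality hiding ([_])
open import Relation.Nullary using (¬_; Dec; yes; no; contradiction)
open import Relation.Unary using (Decidable)

open import Defs

nCk*[k!*[n∸k]!]≡n! : ∀ {n k} → k ℕ.≤ n → (n C k) ℕ.* (k ! ℕ.* (n ℕ.∸ k) !) ≡ n !
nCk*[k!*[n∸k]!]≡n! {n} {k} k≤n = begin
  (n C k) ℕ.* d  ≡⟨ cong (ℕ._* d) (nCk≡n!/k![n-k]! k≤n) ⟩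
  n ! / d ℕ.* d  ≡⟨ m/n*n≡m (k![n∸k]!∣n! k≤n) ⟩
  n !            ∎
  where
  open ≡-Reasoning
  d = k ! ℕ.* (n ℕ.∸ k) !
  instance _ = k ℕ.!* (n ℕ.∸ k) !≢0

n∣n! : ∀ n → .{{NonZero n}} → n ∣ n !
n∣n! (suc n) = m∣m*n (n !)

module _ {p} (p-prime : Prime p) where

  p∤m! : ∀ m → m ℕ.< p → ¬ p ∣ m !
  p∤m! zero    _   p∣1 = ℕ.<-irrefl (sym (∣1⇒≡1 p∣1)) (ℕ.nonTrivial⇒n>1 p {{prime⇒nonTrivial p-prime}})
  p∤m! (suc m) m<p p∣m! with euclidsLemma (suc m) (m !) p-prime p∣m!
  ... | inj₁ p∣1+m = ℕ.<⇒≱ m<p (∣⇒≤ p∣1+m)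
  ... | inj₂ p∣m!′ = p∤m! m (ℕ.<-trans (ℕ.n<1+n m) m<p) p∣m!′

  p∣pCk : ∀ {k} → 0 ℕ.< k → k ℕ.< p → p ∣ p C k
  p∣pCk {k} 0<k k<p
    with euclidsLemma (p C k) (k ! ℕ.* (p ℕ.∸ k) !) p-prime
           (subst (p ∣_) (sym (nCk*[k!*[n∸k]!]≡n! (ℕ.<⇒≤ k<p))) (n∣n! p {{prime⇒nonZero p-prime}}))
  ... | inj₁ p∣pCk′ = p∣pCk′
  ... | inj₂ p∣k!*[p∸k]! with euclidsLemma (k !) ((p ℕ.∸ k) !) p-prime p∣k!*[p∸k]!
  ...   | inj₁ p∣k!     = contradiction p∣k! (p∤m! k k<p)
  ...   | inj₂ p∣[p∸k]! = contradiction p∣[p∸k]! (p∤m! (p ℕ.∸ k) (ℕ.∸-monoʳ-< 0<k (ℕ.<⇒≤ k<p)))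

module ZMod (p : ℕ) {{_ : NonZero p}} where

  [_] : ℕ → Fp p
  [ n ] = n mod p

  toℕ-[] : ∀ n → toℕ [ n ] ≡ n % p
  toℕ-[] n = toℕ-fromℕ< (m%n<n n p)

  []-cong-% : ∀ {m n} → m % p ≡ n % p → [ m ] ≡ [ n ]
  []-cong-% {m} {n} eq = toℕ-injective (trans (toℕ-[] m) (trans eq (sym (toℕ-[] n))))

  []-toℕ : ∀ a → [ toℕ a ] ≡ a
  []-toℕ a = toℕ-injective (trans (toℕ-[] (toℕ a)) (m<n⇒m%n≡m (toℕ<n a)))

  0%p≡0 : 0 % p ≡ 0
  0%p≡0 = m<n⇒m%n≡m (ℕ.>-nonZero⁻¹ p)

  []-elim : {P : Fp p → Set} → (∀ n → P [ n ]) → ∀ a → P a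
  []-elim {P} P[] a = subst P ([]-toℕ a) (P[] (toℕ a))

  infixl 6 _+_
  infixl 7 _*_
  _+_ _*_ : Fp p → Fp p → Fp p
  _+_ = _+F_ p
  _*_ = _*F_ p

  -_ : Fp p → Fp p
  -_ = -F_ p

  +-homo : ∀ m n → [ m ] + [ n ] ≡ [ m ℕ.+ n ]
  +-homo m n = []-cong-% (begin
    (toℕ [ m ] ℕ.+ toℕ [ n ]) % p ≡⟨ cong₂ (λ x y → (x ℕ.+ y) % p) (toℕ-[] m) (toℕ-[] n) ⟩
    ((m % p) ℕ.+ (n % p)) % p     ≡⟨ %-distribˡ-+ m n p ⟨
    (m ℕ.+ n) % p                 ∎)
    where open ≡-Reasoning

  *-homo : ∀ m n → [ m ] * [ n ] ≡ [ m ℕ.* n ]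
  *-homo m n = []-cong-% (begin
    (toℕ [ m ] ℕ.* toℕ [ n ]) % p ≡⟨ cong₂ (λ x y → (x ℕ.* y) % p) (toℕ-[] m) (toℕ-[] n) ⟩
    ((m % p) ℕ.* (n % p)) % p     ≡⟨ %-distribˡ-* m n p ⟨
    (m ℕ.* n) % p                 ∎)
    where open ≡-Reasoning

  0# 1# : Fp p
  0# = 0F p
  1# = 1F p

  +-comm : ∀ a b → a + b ≡ b + a
  +-comm a b = cong [_] (ℕ.+-comm (toℕ a) (toℕ b))

  *-comm : ∀ a b → a * b ≡ b * a
  *-comm a b = cong [_] (ℕ.*-comm (toℕ a) (toℕ b))

  +-assoc : ∀ a b c → (a + b) + c ≡ a + (b + c)
  +-assoc = []-elim λ x → []-elim λ y → []-elim λ z → begin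
    [ x ] + [ y ] + [ z ]   ≡⟨ cong (_+ [ z ]) (+-homo x y) ⟩
    [ x ℕ.+ y ] + [ z ]     ≡⟨ +-homo (x ℕ.+ y) z ⟩
    [ x ℕ.+ y ℕ.+ z ]       ≡⟨ cong [_] (ℕ.+-assoc x y z) ⟩
    [ x ℕ.+ (y ℕ.+ z) ]     ≡⟨ +-homo x (y ℕ.+ z) ⟨
    [ x ] + [ y ℕ.+ z ]     ≡⟨ cong ([ x ] +_) (+-homo y z) ⟨
    [ x ] + ([ y ] + [ z ]) ∎
    where open ≡-Reasoning

  *-assoc : ∀ a b c → (a * b) * c ≡ a * (b * c)
  *-assoc = []-elim λ x → []-elim λ y → []-elim λ z → begin
    [ x ] * [ y ] * [ z ]   ≡⟨ cong (_* [ z ]) (*-homo x y) ⟩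
    [ x ℕ.* y ] * [ z ]     ≡⟨ *-homo (x ℕ.* y) z ⟩
    [ x ℕ.* y ℕ.* z ]       ≡⟨ cong [_] (ℕ.*-assoc x y z) ⟩
    [ x ℕ.* (y ℕ.* z) ]     ≡⟨ *-homo x (y ℕ.* z) ⟨
    [ x ] * [ y ℕ.* z ]     ≡⟨ cong ([ x ] *_) (*-homo y z) ⟨
    [ x ] * ([ y ] * [ z ]) ∎
    where open ≡-Reasoning

  *-distribˡ-+ : ∀ a b c → a * (b + c) ≡ a * b + a * c
  *-distribˡ-+ = []-elim λ x → []-elim λ y → []-elim λ z → begin
    [ x ] * ([ y ] + [ z ])         ≡⟨ cong ([ x ] *_) (+-homo y z) ⟩
    [ x ] * [ y ℕ.+ z ]             ≡⟨ *-homo x (y ℕ.+ z) ⟩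
    [ x ℕ.* (y ℕ.+ z) ]             ≡⟨ cong [_] (ℕ.*-distribˡ-+ x y z) ⟩
    [ x ℕ.* y ℕ.+ x ℕ.* z ]         ≡⟨ +-homo (x ℕ.* y) (x ℕ.* z) ⟨
    [ x ℕ.* y ] + [ x ℕ.* z ]       ≡⟨ cong₂ _+_ (*-homo x y) (*-homo x z) ⟨
    [ x ] * [ y ] + [ x ] * [ z ]   ∎
    where open ≡-Reasoning

  *-distribʳ-+ : ∀ a b c → (b + c) * a ≡ b * a + c * a
  *-distribʳ-+ a b c = begin
    (b + c) * a    ≡⟨ *-comm (b + c) a ⟩
    a * (b + c)    ≡⟨ *-distribˡ-+ a b c ⟩
    a * b + a * c  ≡⟨ cong₂ _+_ (*-comm a b) (*-comm a c) ⟩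
    b * a + c * a  ∎
    where open ≡-Reasoning

  +-identityˡ : ∀ a → 0# + a ≡ a
  +-identityˡ = []-elim (+-homo 0)

  +-identityʳ : ∀ a → a + 0# ≡ a
  +-identityʳ a = trans (+-comm a 0#) (+-identityˡ a)

  *-identityˡ : ∀ a → 1# * a ≡ a
  *-identityˡ = []-elim λ x → trans (*-homo 1 x) (cong [_] (ℕ.*-identityˡ x))

  *-identityʳ : ∀ a → a * 1# ≡ a
  *-identityʳ a = trans (*-comm a 1#) (*-identityˡ a)

  -‿inverseʳ : ∀ a → a + - a ≡ 0#
  -‿inverseʳ a = begin
    a + - a                       ≡⟨ cong (_+ - a) ([]-toℕ a) ⟨
    [ toℕ a ] + [ p ℕ.∸ toℕ a ]   ≡⟨ +-homo (toℕ a) (p ℕ.∸ toℕ a) ⟩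
    [ toℕ a ℕ.+ (p ℕ.∸ toℕ a) ]   ≡⟨ cong [_] (ℕ.m+[n∸m]≡n (ℕ.<⇒≤ (toℕ<n a))) ⟩
    [ p ]                         ≡⟨ []-cong-% (trans (n%n≡0 p) (sym 0%p≡0)) ⟩
    0#                            ∎
    where open ≡-Reasoning

  -‿inverseˡ : ∀ a → - a + a ≡ 0#
  -‿inverseˡ a = trans (+-comm (- a) a) (-‿inverseʳ a)

  isCommutativeRing : IsCommutativeRing _≡_ _+_ _*_ -_ 0# 1#
  isCommutativeRing = record
    { isRing = record
      { +-isAbelianGroup = record
        { isGroup = record
          { isMonoid = record
            { isSemigroup = record
              { isMagma = record { isEquivalence = isEquivalence ; ∙-cong = cong₂ _+_ }
              ; assoc = +-assoc
              }
            ; identity = +-identityˡ , +-identityʳ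
            }
          ; inverse = -‿inverseˡ , -‿inverseʳ
          ; ⁻¹-cong = cong -_
          }
        ; comm = +-comm
        }
      ; *-cong = cong₂ _*_
      ; *-assoc = *-assoc
      ; *-identity = *-identityˡ , *-identityʳ
      ; distrib = *-distribˡ-+ , *-distribʳ-+
      }
    ; *-comm = *-comm
    }

  commutativeRing : CommutativeRing _ _
  commutativeRing = record { isCommutativeRing = isCommutativeRing }

  open CommutativeRing commutativeRing public using (zeroˡ; zeroʳ; commutativeSemiring)
  open CommutativeRing commutativeRing using (ring; +-group; +-abelianGroup)
  open import Algebra.Properties.Group +-group public using (x∙y⁻¹≈ε⇒x≈y; ε⁻¹≈ε; ⁻¹-involutive)
  open import Algebra.Properties.AbelianGroup +-abelianGroup public using (⁻¹-∙-comm)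
  open import Algebra.Properties.Ring ring public using (-‿distribʳ-*)

  []≡0#⇒p∣ : ∀ n → [ n ] ≡ 0# → p ∣ n
  []≡0#⇒p∣ n [n]≡0 = m%n≡0⇒n∣m n p (begin
    n % p        ≡⟨ toℕ-[] n ⟨
    toℕ [ n ]    ≡⟨ cong toℕ [n]≡0 ⟩
    toℕ [ 0 ]    ≡⟨ toℕ-[] 0 ⟩
    0 % p        ≡⟨ 0%p≡0 ⟩
    0            ∎)
    where open ≡-Reasoning

  p∣⇒[]≡0# : ∀ n → p ∣ n → [ n ] ≡ 0#
  p∣⇒[]≡0# n p∣n = []-cong-% (trans (n∣m⇒m%n≡0 n p p∣n) (sym 0%p≡0))

  x-[x-y]≡y : ∀ x y → x + - (x + - y) ≡ y
  x-[x-y]≡y x y = begin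
    x + - (x + - y)     ≡⟨ cong (x +_) (⁻¹-∙-comm x (- y)) ⟨
    x + (- x + - - y)   ≡⟨ cong (λ z → x + (- x + z)) (⁻¹-involutive y) ⟩
    x + (- x + y)       ≡⟨ +-assoc x (- x) y ⟨
    x + - x + y         ≡⟨ cong (_+ y) (-‿inverseʳ x) ⟩
    0# + y              ≡⟨ +-identityˡ y ⟩
    y                   ∎
    where open ≡-Reasoning

  xz≡yz⇒[x-y]z≡0 : ∀ x y z → x * z ≡ y * z → (x + - y) * z ≡ 0#
  xz≡yz⇒[x-y]z≡0 x y z xz≡yz = begin
    (x + - y) * z     ≡⟨ *-distribʳ-+ z x (- y) ⟩
    x * z + - y * z   ≡⟨ cong (_+ - y * z) xz≡yz ⟩
    y * z + - y * z   ≡⟨ *-distribʳ-+ z y (- y) ⟨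
    (y + - y) * z     ≡⟨ cong (_* z) (-‿inverseʳ y) ⟩
    0# * z            ≡⟨ zeroˡ z ⟩
    0#                ∎
    where open ≡-Reasoning

  module _ (p-prime : Prime p) where

    x*y≡0⇒x≡0∨y≡0 : ∀ x y → x * y ≡ 0# → x ≡ 0# ⊎ y ≡ 0#
    x*y≡0⇒x≡0∨y≡0 x y xy≡0 = Sum.map (residue≡0 x) (residue≡0 y)
      (euclidsLemma (toℕ x) (toℕ y) p-prime ([]≡0#⇒p∣ (toℕ x ℕ.* toℕ y) xy≡0))
      where
      residue≡0 : ∀ a → p ∣ toℕ a → a ≡ 0#
      residue≡0 a p∣a = trans (sym ([]-toℕ a)) (p∣⇒[]≡0# (toℕ a) p∣a)

    x≢y∧xz≡yz⇒z≡0 : ∀ x y z → x ≢ y → x * z ≡ y * z → z ≡ 0#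
    x≢y∧xz≡yz⇒z≡0 x y z x≢y xz≡yz with x*y≡0⇒x≡0∨y≡0 (x + - y) z (xz≡yz⇒[x-y]z≡0 x y z xz≡yz)
    ... | inj₁ x-y≡0 = ⊥-elim (x≢y (x∙y⁻¹≈ε⇒x≈y x y x-y≡0))
    ... | inj₂ z≡0   = z≡0

module Polynomial (p : ℕ) {{_ : NonZero p}} where

  open ZMod p
  open import Algebra.Solver.Ring.NaturalCoefficients.Default commutativeSemiring using (solve; _:+_; _:*_; _:=_)

  Poly : Set
  Poly = Poly1 p

  coeff : Poly → ℕ → Fp p
  coeff = coeff1 p

  eval : Fp p → Poly → Fp p
  eval = eval1 p

  -- A record rather than the function _≈1_ of Defs, so that Agda can infer the two polynomials.
  infix 4 _≈_
  record _≈_ (f g : Poly) : Set where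
    constructor coeffwise
    field coeff-≡ : ∀ i → coeff f i ≡ coeff g i
  open _≈_ public

  infixl 6 _⊞_
  _⊞_ : Poly → Poly → Poly
  _⊞_ = add1 p

  infixl 7 _⊠_
  _⊠_ : Poly → Poly → Poly
  _⊠_ = mul1 p

  infixr 8 _·_
  _·_ : Fp p → Poly → Poly
  a · f = map (a *_) f

  ≈-refl : ∀ {f} → f ≈ f
  ≈-refl = coeffwise λ _ → refl

  ≈-sym : ∀ {f g} → f ≈ g → g ≈ f
  ≈-sym f≈g = coeffwise λ i → sym (coeff-≡ f≈g i)

  ≈-trans : ∀ {f g h} → f ≈ g → g ≈ h → f ≈ h
  ≈-trans f≈g g≈h = coeffwise λ i → trans (coeff-≡ f≈g i) (coeff-≡ g≈h i)

  ≈-setoid : Setoid _ _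
  ≈-setoid = record
    { Carrier = Poly
    ; _≈_ = _≈_
    ; isEquivalence = record { refl = ≈-refl ; sym = ≈-sym ; trans = ≈-trans }
    }

  ∷-cong : ∀ {a b f g} → a ≡ b → f ≈ g → a ∷ f ≈ b ∷ g
  ∷-cong a≡b f≈g = coeffwise λ where
    zero    → a≡b
    (suc i) → coeff-≡ f≈g i

  ∷-tail : ∀ {a b f g} → a ∷ f ≈ b ∷ g → f ≈ g
  ∷-tail f≈g = coeffwise (coeff-≡ f≈g ∘ suc)

  ∷-tail-≈[] : ∀ {a f} → a ∷ f ≈ [] → f ≈ []
  ∷-tail-≈[] f≈0 = coeffwise (coeff-≡ f≈0 ∘ suc)

  coeff-⊞ : ∀ f g i → coeff (f ⊞ g) i ≡ coeff f i + coeff g i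
  coeff-⊞ []      g       i       = sym (+-identityˡ _)
  coeff-⊞ (a ∷ f) []      i       = sym (+-identityʳ _)
  coeff-⊞ (a ∷ f) (b ∷ g) zero    = refl
  coeff-⊞ (a ∷ f) (b ∷ g) (suc i) = coeff-⊞ f g i

  coeff-· : ∀ a g i → coeff (a · g) i ≡ a * coeff g i
  coeff-· a []      i       = sym (zeroʳ a)
  coeff-· a (b ∷ g) zero    = refl
  coeff-· a (b ∷ g) (suc i) = coeff-· a g i

  coeff-drop : ∀ k f i → coeff (drop k f) i ≡ coeff f (k ℕ.+ i)
  coeff-drop zero    f       i = refl
  coeff-drop (suc k) []      i = refl
  coeff-drop (suc k) (a ∷ f) i = coeff-drop k f i

  ⊞-congʳ : ∀ f {g h} → g ≈ h → f ⊞ g ≈ f ⊞ h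
  ⊞-congʳ f {g} {h} g≈h = coeffwise λ i → begin
    coeff (f ⊞ g) i       ≡⟨ coeff-⊞ f g i ⟩
    coeff f i + coeff g i ≡⟨ cong (coeff f i +_) (coeff-≡ g≈h i) ⟩
    coeff f i + coeff h i ≡⟨ coeff-⊞ f h i ⟨
    coeff (f ⊞ h) i       ∎
    where open ≡-Reasoning

  ⊞-identityʳ : ∀ f {g} → g ≈ [] → f ⊞ g ≈ f
  ⊞-identityʳ f {g} g≈0 = coeffwise λ i →
    trans (coeff-⊞ f g i) (trans (cong (coeff f i +_) (coeff-≡ g≈0 i)) (+-identityʳ _))

  eval-⊞ : ∀ c f g → eval c (f ⊞ g) ≡ eval c f + eval c g
  eval-⊞ c []      g       = sym (+-identityˡ _)
  eval-⊞ c (a ∷ f) []      = sym (+-identityʳ _)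
  eval-⊞ c (a ∷ f) (b ∷ g) = begin
    a + b + c * eval c (f ⊞ g)               ≡⟨ cong (λ e → a + b + c * e) (eval-⊞ c f g) ⟩
    a + b + c * (eval c f + eval c g)
      ≡⟨ solve 5 (λ a b c F G → a :+ b :+ c :* (F :+ G) := a :+ c :* F :+ (b :+ c :* G))
               refl a b c (eval c f) (eval c g) ⟩
    a + c * eval c f + (b + c * eval c g)    ∎
    where open ≡-Reasoning

  eval-· : ∀ c a g → eval c (a · g) ≡ a * eval c g
  eval-· c a []      = sym (zeroʳ a)
  eval-· c a (b ∷ g) = begin
    a * b + c * eval c (a · g)  ≡⟨ cong (λ e → a * b + c * e) (eval-· c a g) ⟩
    a * b + c * (a * eval c g)
      ≡⟨ solve 4 (λ a b c G → a :* b :+ c :* (a :* G) := a :* (b :+ c :* G)) refl a b c (eval c g) ⟩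
    a * (b + c * eval c g)      ∎
    where open ≡-Reasoning

  eval-⊠ : ∀ c f g → eval c (f ⊠ g) ≡ eval c f * eval c g
  eval-⊠ c []      g = sym (zeroˡ _)
  eval-⊠ c (a ∷ f) g = begin
    eval c (a · g ⊞ (0# ∷ f ⊠ g))
      ≡⟨ eval-⊞ c (a · g) (0# ∷ f ⊠ g) ⟩
    eval c (a · g) + (0# + c * eval c (f ⊠ g))
      ≡⟨ cong₂ _+_ (eval-· c a g) (trans (+-identityˡ _) (cong (c *_) (eval-⊠ c f g))) ⟩
    a * eval c g + c * (eval c f * eval c g)
      ≡⟨ solve 4 (λ a c F G → a :* G :+ c :* (F :* G) := (a :+ c :* F) :* G) refl a c (eval c f) (eval c g) ⟩
    (a + c * eval c f) * eval c g
      ∎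
    where open ≡-Reasoning

  eval-≈[] : ∀ c {f} → f ≈ [] → eval c f ≡ 0#
  eval-≈[] c {[]}    f≈0 = refl
  eval-≈[] c {a ∷ f} f≈0 = begin
    a + c * eval c f ≡⟨ cong₂ (λ x y → x + c * y) (coeff-≡ f≈0 zero) (eval-≈[] c (∷-tail-≈[] f≈0)) ⟩
    0# + c * 0#      ≡⟨ trans (+-identityˡ _) (zeroʳ c) ⟩
    0#               ∎
    where open ≡-Reasoning

  eval-cong : ∀ c {f g} → f ≈ g → eval c f ≡ eval c g
  eval-cong c {[]}    {g}     f≈g = sym (eval-≈[] c (≈-sym f≈g))
  eval-cong c {a ∷ f} {[]}    f≈0 = eval-≈[] c f≈0
  eval-cong c {a ∷ f} {b ∷ g} f≈g = cong₂ (λ x y → x + c * y) (coeff-≡ f≈g zero) (eval-cong c (∷-tail f≈g))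

  eval-neg : ∀ c f → eval c (neg1 p f) ≡ - eval c f
  eval-neg c []      = sym ε⁻¹≈ε
  eval-neg c (b ∷ f) = begin
    - b + c * eval c (neg1 p f)   ≡⟨ cong (λ e → - b + c * e) (eval-neg c f) ⟩
    - b + c * - eval c f          ≡⟨ cong (- b +_) (-‿distribʳ-* c (eval c f)) ⟨
    - b + - (c * eval c f)        ≡⟨ ⁻¹-∙-comm b (c * eval c f) ⟩
    - (b + c * eval c f)          ∎
    where open ≡-Reasoning

  drop-cong : ∀ k {f g} → f ≈ g → drop k f ≈ drop k g
  drop-cong k {f} {g} f≈g = coeffwise λ i →
    trans (coeff-drop k f i) (trans (coeff-≡ f≈g (k ℕ.+ i)) (sym (coeff-drop k g i)))

  -- Synthetic division: quot c f is the quotient of f by x − c and eval c f the remainder.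
  quot : Fp p → Poly → Poly
  quot c []      = []
  quot c (a ∷ f) = eval c f ∷ quot c f

  coeff-quot : ∀ c f i → coeff (quot c f) i ≡ eval c (drop (suc i) f)
  coeff-quot c []      i       = refl
  coeff-quot c (a ∷ f) zero    = refl
  coeff-quot c (a ∷ f) (suc i) = coeff-quot c f i

  quot-cong : ∀ c {f g} → f ≈ g → quot c f ≈ quot c g
  quot-cong c {f} {g} f≈g = coeffwise λ i → begin
    coeff (quot c f) i           ≡⟨ coeff-quot c f i ⟩
    eval c (drop (suc i) f)      ≡⟨ eval-cong c (drop-cong (suc i) f≈g) ⟩
    eval c (drop (suc i) g)      ≡⟨ coeff-quot c g i ⟨
    coeff (quot c g) i           ∎
    where open ≡-Reasoning

  quot-⊞ : ∀ c f g → quot c (f ⊞ g) ≡ quot c f ⊞ quot c g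
  quot-⊞ c []      g       = refl
  quot-⊞ c (a ∷ f) []      = refl
  quot-⊞ c (a ∷ f) (b ∷ g) = cong₂ _∷_ (eval-⊞ c f g) (quot-⊞ c f g)

  quot-· : ∀ c a g → quot c (a · g) ≡ a · quot c g
  quot-· c a []      = refl
  quot-· c a (b ∷ g) = cong₂ _∷_ (eval-· c a g) (quot-· c a g)

  -- The left-hand side is x · quot c f + eval c f.
  division-identity : ∀ c f → eval c f ∷ quot c f ≈ f ⊞ c · quot c f
  division-identity c []      = coeffwise λ where
    zero    → refl
    (suc i) → refl
  division-identity c (a ∷ f) = ∷-cong refl (division-identity c f)

  coeff-division-identity : ∀ c f i → coeff (eval c f ∷ quot c f) i ≡ coeff f i + c * coeff (quot c f) i
  coeff-division-identity c f i = begin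
    coeff (eval c f ∷ quot c f) i            ≡⟨ coeff-≡ (division-identity c f) i ⟩
    coeff (f ⊞ c · quot c f) i               ≡⟨ coeff-⊞ f (c · quot c f) i ⟩
    coeff f i + coeff (c · quot c f) i       ≡⟨ cong (coeff f i +_) (coeff-· c (quot c f) i) ⟩
    coeff f i + c * coeff (quot c f) i       ∎
    where open ≡-Reasoning

  -- f(c) − f(d) = (c − d) · (quot d f)(c), stated without subtraction.
  eval-division-identity : ∀ c d f → eval c f + d * eval c (quot d f) ≡ eval d f + c * eval c (quot d f)
  eval-division-identity c d f = begin
    eval c f + d * eval c (quot d f)      ≡⟨ cong (eval c f +_) (eval-· c d (quot d f)) ⟨
    eval c f + eval c (d · quot d f)      ≡⟨ eval-⊞ c f (d · quot d f) ⟨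
    eval c (f ⊞ d · quot d f)             ≡⟨ eval-cong c (division-identity d f) ⟨
    eval c (eval d f ∷ quot d f)          ∎
    where open ≡-Reasoning

  eval-quot-comm : ∀ c d f → eval d (quot c f) ≡ eval c (quot d f)
  eval-quot-comm c d []      = refl
  eval-quot-comm c d (a ∷ f) = begin
    eval c f + d * eval d (quot c f)   ≡⟨ cong (λ e → eval c f + d * e) (eval-quot-comm c d f) ⟩
    eval c f + d * eval c (quot d f)   ≡⟨ eval-division-identity c d f ⟩
    eval d f + c * eval c (quot d f)   ∎
    where open ≡-Reasoning

  quot-comm : ∀ c d f → quot d (quot c f) ≡ quot c (quot d f)
  quot-comm c d []      = refl
  quot-comm c d (a ∷ f) = cong₂ _∷_ (eval-quot-comm c d f) (quot-comm c d f)

  root∧quot≈[]⇒≈[] : ∀ c f → eval c f ≡ 0# → quot c f ≈ [] → f ≈ []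
  root∧quot≈[]⇒≈[] c []      _      _      = ≈-refl
  root∧quot≈[]⇒≈[] c (a ∷ f) f[c]≡0 quot≈0 = coeffwise λ where
      zero    → a≡0
      (suc i) → coeff-≡ (root∧quot≈[]⇒≈[] c f (coeff-≡ quot≈0 zero) (∷-tail-≈[] quot≈0)) i
    where
    a≡0 : a ≡ 0#
    a≡0 = begin
      a                     ≡⟨ +-identityʳ a ⟨
      a + 0#                ≡⟨ cong (a +_) (zeroʳ c) ⟨
      a + c * 0#            ≡⟨ cong (λ e → a + c * e) (coeff-≡ quot≈0 zero) ⟨
      a + c * eval c f      ≡⟨ f[c]≡0 ⟩
      0#                    ∎
      where open ≡-Reasoning

  quot-⊠-root : ∀ c h g → eval c g ≡ 0# → quot c (h ⊠ g) ≈ h ⊠ quot c g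
  quot-⊠-root c []      g g[c]≡0 = ≈-refl
  quot-⊠-root c (a ∷ h) g g[c]≡0 = begin
    quot c (a · g ⊞ (0# ∷ h ⊠ g))
      ≡⟨ quot-⊞ c (a · g) (0# ∷ h ⊠ g) ⟩
    quot c (a · g) ⊞ (eval c (h ⊠ g) ∷ quot c (h ⊠ g))
      ≡⟨ cong (_⊞ _) (quot-· c a g) ⟩
    a · quot c g ⊞ (eval c (h ⊠ g) ∷ quot c (h ⊠ g))
      ≈⟨ ⊞-congʳ (a · quot c g) (∷-cong hg[c]≡0 (quot-⊠-root c h g g[c]≡0)) ⟩
    a · quot c g ⊞ (0# ∷ h ⊠ quot c g)
      ∎
    where
    open import Relation.Binary.Reasoning.Setoid ≈-setoid
    hg[c]≡0 : eval c (h ⊠ g) ≡ 0#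
    hg[c]≡0 = trans (eval-⊠ c h g) (trans (cong (eval c h *_) g[c]≡0) (zeroʳ (eval c h)))

  quot-⊠ : ∀ c f g → quot c (f ⊠ g) ≈ quot c f ⊠ g ⊞ eval c f · quot c g
  quot-⊠ c []      g = coeffwise λ i → sym (trans (coeff-· 0# (quot c g) i) (zeroˡ _))
  quot-⊠ c (a ∷ f) g = coeffwise λ i → begin
    coeff (quot c (a · g ⊞ (0# ∷ f ⊠ g))) i
      ≡⟨ cong (λ h → coeff h i) (quot-⊞ c (a · g) (0# ∷ f ⊠ g)) ⟩
    coeff (quot c (a · g) ⊞ (eval c (f ⊠ g) ∷ quot c (f ⊠ g))) i
      ≡⟨ coeff-⊞ (quot c (a · g)) _ i ⟩
    coeff (quot c (a · g)) i + coeff (eval c (f ⊠ g) ∷ quot c (f ⊠ g)) i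
      ≡⟨ cong₂ _+_ (trans (cong (λ h → coeff h i) (quot-· c a g)) (coeff-· a (quot c g) i)) (shifted-IH i) ⟩
    a * q i + (M i + F * coeff (eval c g ∷ quot c g) i)
      ≡⟨ cong (λ e → a * q i + (M i + F * e)) (coeff-division-identity c g i) ⟩
    a * q i + (M i + F * (coeff g i + c * q i))
      ≡⟨ solve 6 (λ a qᵢ Mᵢ F gᵢ c →
                    a :* qᵢ :+ (Mᵢ :+ F :* (gᵢ :+ c :* qᵢ)) := F :* gᵢ :+ Mᵢ :+ (a :+ c :* F) :* qᵢ)
               refl a (q i) (M i) F (coeff g i) c ⟩
    F * coeff g i + M i + (a + c * F) * q i
      ≡⟨ cong₂ (λ x y → x + M i + y) (coeff-· F g i) (coeff-· (a + c * F) (quot c g) i) ⟨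
    coeff (F · g) i + M i + coeff ((a + c * F) · quot c g) i
      ≡⟨ cong (_+ coeff ((a + c * F) · quot c g) i) (coeff-⊞ (F · g) (0# ∷ quot c f ⊠ g) i) ⟨
    coeff (F · g ⊞ (0# ∷ quot c f ⊠ g)) i + coeff ((a + c * F) · quot c g) i
      ≡⟨ coeff-⊞ (F · g ⊞ (0# ∷ quot c f ⊠ g)) ((a + c * F) · quot c g) i ⟨
    coeff (F · g ⊞ (0# ∷ quot c f ⊠ g) ⊞ (a + c * F) · quot c g) i ∎
    where
    open ≡-Reasoning
    F = eval c f
    q = coeff (quot c g)
    M = coeff (0# ∷ quot c f ⊠ g)
    shifted-IH : ∀ i → coeff (eval c (f ⊠ g) ∷ quot c (f ⊠ g)) i ≡ M i + F * coeff (eval c g ∷ quot c g) i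
    shifted-IH zero    = trans (eval-⊠ c f g) (sym (+-identityˡ _))
    shifted-IH (suc j) = begin
      coeff (quot c (f ⊠ g)) j                         ≡⟨ coeff-≡ (quot-⊠ c f g) j ⟩
      coeff (quot c f ⊠ g ⊞ F · quot c g) j            ≡⟨ coeff-⊞ (quot c f ⊠ g) (F · quot c g) j ⟩
      coeff (quot c f ⊠ g) j + coeff (F · quot c g) j  ≡⟨ cong (M (suc j) +_) (coeff-· F (quot c g) j) ⟩
      coeff (quot c f ⊠ g) j + F * q j                 ∎

  Degree< : Poly → ℕ → Set
  Degree< f k = ∀ i → k ℕ.≤ i → coeff f i ≡ 0#

  quot-degree< : ∀ c f k → Degree< f (suc k) → Degree< (quot c f) k
  quot-degree< c f k deg i k≤i = trans (coeff-quot c f i) (eval-≈[] c {drop (suc i) f} (coeffwise λ j →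
    trans (coeff-drop (suc i) f j) (deg (suc i ℕ.+ j) (ℕ.s≤s (ℕ.≤-trans k≤i (ℕ.m≤m+n i j))))))

  -- (x − c)^k divides f.
  data VanishesToOrder (c : Fp p) : ℕ → Poly → Set where
    order0 : ∀ {f} → VanishesToOrder c 0 f
    root   : ∀ {k f} → eval c f ≡ 0# → VanishesToOrder c k (quot c f) → VanishesToOrder c (suc k) f

  vanishes-cong : ∀ {c k f g} → f ≈ g → VanishesToOrder c k f → VanishesToOrder c k g
  vanishes-cong f≈g order0                 = order0
  vanishes-cong {c} f≈g (root f[c]≡0 vanishes) =
    root (trans (sym (eval-cong c f≈g)) f[c]≡0) (vanishes-cong (quot-cong c f≈g) vanishes)

  vanishes-≤ : ∀ {c j k f} → j ℕ.≤ k → VanishesToOrder c k f → VanishesToOrder c j f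
  vanishes-≤ ℕ.z≤n       _                        = order0
  vanishes-≤ (ℕ.s≤s j≤k) (root f[c]≡0 vanishes) = root f[c]≡0 (vanishes-≤ j≤k vanishes)

  vanishes-⊞-cancelˡ : ∀ {c k} f g →
                       VanishesToOrder c k (f ⊞ g) → VanishesToOrder c k f → VanishesToOrder c k g
  vanishes-⊞-cancelˡ f g order0 order0 = order0
  vanishes-⊞-cancelˡ {c} f g (root [f+g][c]≡0 vanishes-f+g) (root f[c]≡0 vanishes-f) =
    root g[c]≡0 (vanishes-⊞-cancelˡ (quot c f) (quot c g)
                  (subst (VanishesToOrder c _) (quot-⊞ c f g) vanishes-f+g) vanishes-f)
    where
    g[c]≡0 : eval c g ≡ 0#
    g[c]≡0 = begin
      eval c g             ≡⟨ +-identityˡ (eval c g) ⟨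
      0# + eval c g        ≡⟨ cong (_+ eval c g) f[c]≡0 ⟨
      eval c f + eval c g  ≡⟨ eval-⊞ c f g ⟨
      eval c (f ⊞ g)       ≡⟨ [f+g][c]≡0 ⟩
      0#                   ∎
      where open ≡-Reasoning

  vanishes-⊠ʳ : ∀ {c k} h g → VanishesToOrder c k g → VanishesToOrder c k (h ⊠ g)
  vanishes-⊠ʳ h g order0 = order0
  vanishes-⊠ʳ {c} h g (root g[c]≡0 vanishes) =
    root (trans (eval-⊠ c h g) (trans (cong (eval c h *_) g[c]≡0) (zeroʳ (eval c h))))
         (vanishes-cong (≈-sym (quot-⊠-root c h g g[c]≡0)) (vanishes-⊠ʳ h (quot c g) vanishes))

  vanishes-⊠ : ∀ {c j k} f g →
               VanishesToOrder c j f → VanishesToOrder c k g → VanishesToOrder c (j ℕ.+ k) (f ⊠ g)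
  vanishes-⊠ f g order0 vanishes-g = vanishes-⊠ʳ f g vanishes-g
  vanishes-⊠ {c} f g (root f[c]≡0 vanishes-f) vanishes-g =
    root (trans (eval-⊠ c f g) (trans (cong (_* eval c g) f[c]≡0) (zeroˡ (eval c g))))
         (vanishes-cong (≈-sym quot[fg]≈quot[f]g) (vanishes-⊠ (quot c f) g vanishes-f vanishes-g))
    where
    quot[fg]≈quot[f]g : quot c (f ⊠ g) ≈ quot c f ⊠ g
    quot[fg]≈quot[f]g = ≈-trans (quot-⊠ c f g) (⊞-identityʳ (quot c f ⊠ g) (coeffwise λ i →
      trans (coeff-· (eval c f) (quot c g) i) (trans (cong (_* coeff (quot c g) i) f[c]≡0) (zeroˡ _))))

  vanishes-⊠ˡ : ∀ {c k} f g → VanishesToOrder c k f → VanishesToOrder c k (f ⊠ g)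
  vanishes-⊠ˡ {c} f g vanishes =
    subst (λ k → VanishesToOrder c k (f ⊠ g)) (ℕ.+-identityʳ _) (vanishes-⊠ f g vanishes order0)

  vanishes-pow : ∀ {c} f n → eval c f ≡ 0# → VanishesToOrder c n (pow1 p f n)
  vanishes-pow f zero    f[c]≡0 = order0
  vanishes-pow f (suc n) f[c]≡0 = vanishes-⊠ f (pow1 p f n) (root f[c]≡0 order0) (vanishes-pow f n f[c]≡0)

  multiplicity : Fp p → List (Fp p) → ℕ
  multiplicity c cs = length (filter (_≟ c) cs)

  multiplicity-∷-≡ : ∀ {c d} cs → c ≡ d → multiplicity d (c ∷ cs) ≡ suc (multiplicity d cs)
  multiplicity-∷-≡ cs c≡d = cong length (filter-accept (_≟ _) c≡d)

  multiplicity-∷-≢ : ∀ {c d} cs → c ≢ d → multiplicity d (c ∷ cs) ≡ multiplicity d cs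
  multiplicity-∷-≢ cs c≢d = cong length (filter-reject (_≟ _) c≢d)

  module _ (p-prime : Prime p) where

    eval-quot≡0 : ∀ {c d} t → d ≢ c → eval c t ≡ 0# → eval d t ≡ 0# → eval c (quot d t) ≡ 0#
    eval-quot≡0 {c} {d} t d≢c t[c]≡0 t[d]≡0 = x≢y∧xz≡yz⇒z≡0 p-prime d c (eval c (quot d t)) d≢c (begin
      d * eval c (quot d t)            ≡⟨ +-identityˡ _ ⟨
      0# + d * eval c (quot d t)       ≡⟨ cong (_+ d * eval c (quot d t)) t[c]≡0 ⟨
      eval c t + d * eval c (quot d t) ≡⟨ eval-division-identity c d t ⟩
      eval d t + c * eval c (quot d t) ≡⟨ cong (_+ c * eval c (quot d t)) t[d]≡0 ⟩
      0# + c * eval c (quot d t)       ≡⟨ +-identityˡ _ ⟩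
      c * eval c (quot d t)            ∎)
      where open ≡-Reasoning

    vanishes-quot : ∀ {c d k t} → d ≢ c → eval c t ≡ 0# → VanishesToOrder d k t → VanishesToOrder d k (quot c t)
    vanishes-quot d≢c t[c]≡0 order0 = order0
    vanishes-quot {c} {d} {t = t} d≢c t[c]≡0 (root t[d]≡0 vanishes) =
      root (trans (eval-quot-comm c d t) quot[d]t[c]≡0)
           (subst (VanishesToOrder d _) (sym (quot-comm c d t)) (vanishes-quot d≢c quot[d]t[c]≡0 vanishes))
      where
      quot[d]t[c]≡0 : eval c (quot d t) ≡ 0#
      quot[d]t[c]≡0 = eval-quot≡0 t d≢c t[c]≡0 t[d]≡0

    vanishing-at-roots⇒≈[] : ∀ cs t → Degree< t (length cs) →
                             (∀ c → VanishesToOrder c (multiplicity c cs) t) → t ≈ []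
    vanishing-at-roots⇒≈[] []       t deg _ = coeffwise λ i → deg i ℕ.z≤n
    vanishing-at-roots⇒≈[] (c ∷ cs) t deg vanishes
      with subst (λ k → VanishesToOrder c k t) (multiplicity-∷-≡ cs refl) (vanishes c)
    ... | root t[c]≡0 quot-vanishes-at-c =
      root∧quot≈[]⇒≈[] c t t[c]≡0
        (vanishing-at-roots⇒≈[] cs (quot c t) (quot-degree< c t (length cs) deg) quot-vanishes)
      where
      quot-vanishes : ∀ d → VanishesToOrder d (multiplicity d cs) (quot c t)
      quot-vanishes d with d ≟ c
      ... | yes refl = quot-vanishes-at-c
      ... | no d≢c   = vanishes-quot d≢c t[c]≡0
                         (subst (λ k → VanishesToOrder d k t) (multiplicity-∷-≢ cs (d≢c ∘ sym)) (vanishes d))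

module Fermat (p : ℕ) {{_ : NonZero p}} where

  open ZMod p
  open CommutativeRing commutativeRing using (semiring; +-monoid)
  open import Algebra.Properties.Semiring.Mult semiring using (_×_; ×-assoc-*)
  open import Algebra.Properties.Semiring.Exp semiring using (_^_)
  open import Algebra.Properties.CommutativeSemiring.Binomial commutativeSemiring using (theorem; binomialTerm)
  open import Algebra.Properties.Monoid.Sum +-monoid using (sum; sum-init-last; sum-cong-≋; sum-replicate-zero)
  open Polynomial p using (eval; _⊞_; eval-⊞; eval-neg)

  ×1#≡[] : ∀ n → n × 1# ≡ [ n ]
  ×1#≡[] zero    = refl
  ×1#≡[] (suc n) = trans (cong (1# +_) (×1#≡[] n)) (+-homo 1 n)

  []≡0#⇒×≡0# : ∀ n x → [ n ] ≡ 0# → n × x ≡ 0#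
  []≡0#⇒×≡0# n x [n]≡0 = begin
    n × x          ≡⟨ cong (n ×_) (*-identityˡ x) ⟨
    n × (1# * x)   ≡⟨ ×-assoc-* n 1# x ⟨
    n × 1# * x     ≡⟨ cong (_* x) (trans (×1#≡[] n) [n]≡0) ⟩
    0# * x         ≡⟨ zeroˡ x ⟩
    0#             ∎
    where open ≡-Reasoning

  binomial-collapse : ∀ n → .{{NonZero n}} → (∀ k → 0 ℕ.< k → k ℕ.< n → [ n C k ] ≡ 0#) →
                      ∀ x y → (x + y) ^ n ≡ x ^ n + y ^ n
  binomial-collapse (suc m) middle≡0 x y = begin
    (x + y) ^ suc m
      ≡⟨ theorem (suc m) x y ⟩
    t Fin.zero + sum (tail t)
      ≡⟨ cong (t Fin.zero +_) (sum-init-last (tail t)) ⟩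
    t Fin.zero + (sum (init (tail t)) + last (tail t))
      ≡⟨ cong₂ (λ u v → t Fin.zero + (u + v)) middle-sum≡0 last-term ⟩
    1# * y ^ suc m + 0# + (0# + x ^ suc m)
      ≡⟨ cong₂ _+_ (trans (+-identityʳ _) (*-identityˡ _)) (+-identityˡ _) ⟩
    y ^ suc m + x ^ suc m
      ≡⟨ +-comm (y ^ suc m) (x ^ suc m) ⟩
    x ^ suc m + y ^ suc m
      ∎
    where
    open ≡-Reasoning
    t = binomialTerm x y (suc m)

    middle-term≡0 : ∀ i → init (tail t) i ≡ 0#
    middle-term≡0 i = []≡0#⇒×≡0# (suc m C k) _ (middle≡0 k (ℕ.s≤s ℕ.z≤n) (ℕ.s≤s k-1<m))
      where
      k = suc (toℕ (inject₁ i))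
      k-1<m : toℕ (inject₁ i) ℕ.< m
      k-1<m = subst (ℕ._< m) (sym (toℕ-inject₁ i)) (toℕ<n i)

    middle-sum≡0 : sum (init (tail t)) ≡ 0#
    middle-sum≡0 = trans (sum-cong-≋ {m} {init (tail t)} {λ _ → 0#} middle-term≡0) (sum-replicate-zero m)

    last-term : last (tail t) ≡ x ^ suc m
    last-term = begin
      term (toℕ (Fin.fromℕ m))
        ≡⟨ cong term (toℕ-fromℕ m) ⟩
      (suc m C suc m) × (x ^ suc m * y ^ (m ℕ.∸ m))
        ≡⟨ cong₂ (λ c e → c × (x ^ suc m * y ^ e)) (nCn≡1 (suc m)) (ℕ.n∸n≡0 m) ⟩
      x ^ suc m * 1# + 0#
        ≡⟨ trans (+-identityʳ _) (*-identityʳ _) ⟩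
      x ^ suc m
        ∎
      where
      term : ℕ → Fp p
      term k = (suc m C suc k) × (x ^ suc k * y ^ (m ℕ.∸ k))

  0^n≡0 : ∀ n → .{{NonZero n}} → 0# ^ n ≡ 0#
  0^n≡0 (suc n) = zeroˡ _

  1^n≡1 : ∀ n → 1# ^ n ≡ 1#
  1^n≡1 zero    = refl
  1^n≡1 (suc n) = trans (*-identityˡ _) (1^n≡1 n)

  eval-mon : ∀ c k → eval c (mon1 p k) ≡ c ^ k
  eval-mon c zero    = trans (cong (1# +_) (zeroʳ c)) (+-identityʳ 1#)
  eval-mon c (suc k) = trans (+-identityˡ _) (cong (c *_) (eval-mon c k))

  module _ (p-prime : Prime p) where

    freshman's-dream : ∀ x y → (x + y) ^ p ≡ x ^ p + y ^ p
    freshman's-dream = binomial-collapse p λ k 0<k k<p → p∣⇒[]≡0# (p C k) (p∣pCk p-prime 0<k k<p)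

    fermat : ∀ x → x ^ p ≡ x
    fermat = []-elim fermat-[]
      where
      fermat-[] : ∀ n → [ n ] ^ p ≡ [ n ]
      fermat-[] zero    = 0^n≡0 p
      fermat-[] (suc n) = begin
        [ suc n ] ^ p           ≡⟨ cong (_^ p) (+-homo 1 n) ⟨
        ([ 1 ] + [ n ]) ^ p     ≡⟨ freshman's-dream [ 1 ] [ n ] ⟩
        [ 1 ] ^ p + [ n ] ^ p   ≡⟨ cong₂ _+_ (1^n≡1 p) (fermat-[] n) ⟩
        [ 1 ] + [ n ]           ≡⟨ +-homo 1 n ⟩
        [ suc n ]               ∎
        where open ≡-Reasoning

    eval-xpx≡0 : ∀ c → eval c (xpx p) ≡ 0#
    eval-xpx≡0 c = begin
      eval c (mon1 p p ⊞ neg1 p (mon1 p 1))            ≡⟨ eval-⊞ c (mon1 p p) (neg1 p (mon1 p 1)) ⟩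
      eval c (mon1 p p) + eval c (neg1 p (mon1 p 1))   ≡⟨ cong₂ _+_ (trans (eval-mon c p) (fermat c)) eval[-x]≡-c ⟩
      c + - c                                          ≡⟨ -‿inverseʳ c ⟩
      0#                                               ∎
      where
      open ≡-Reasoning
      eval[-x]≡-c : eval c (neg1 p (mon1 p 1)) ≡ - c
      eval[-x]≡-c = trans (eval-neg c (mon1 p 1)) (cong -_ (trans (eval-mon c 1) (*-identityʳ c)))

module Specialisation (p : ℕ) {{_ : NonZero p}} (m : Fp p) where

  open import Data.Product using (_×_)
  open ZMod p
  open Polynomial p

  specialise : Poly2 p → Poly
  specialise = evalY p m

  coeff-specialise : ∀ F i → coeff (specialise F) i ≡ eval m (coeff2 p F i)
  coeff-specialise []      i       = refl
  coeff-specialise (f ∷ F) zero    = refl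
  coeff-specialise (f ∷ F) (suc i) = coeff-specialise F i

  specialise-cong : ∀ F G → _≈2_ p F G → specialise F ≈ specialise G
  specialise-cong F G F≈G = coeffwise λ i → begin
    coeff (specialise F) i     ≡⟨ coeff-specialise F i ⟩
    eval m (coeff2 p F i)      ≡⟨ eval-cong m {coeff2 p F i} {coeff2 p G i} (coeffwise (F≈G i)) ⟩
    eval m (coeff2 p G i)      ≡⟨ coeff-specialise G i ⟨
    coeff (specialise G) i     ∎
    where open ≡-Reasoning

  specialise-degree< : ∀ T d → degX< p T d → Degree< (specialise T) d
  specialise-degree< T d deg i d≤i = trans (coeff-specialise T i) (eval-≈[] m {coeff2 p T i} (coeffwise (deg i d≤i)))

  specialise-add2 : ∀ F G → specialise (add2 p F G) ≡ specialise F ⊞ specialise G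
  specialise-add2 []      G       = refl
  specialise-add2 (f ∷ F) []      = refl
  specialise-add2 (f ∷ F) (g ∷ G) = cong₂ _∷_ (eval-⊞ m f g) (specialise-add2 F G)

  specialise-map-mul1 : ∀ f G → specialise (map (mul1 p f) G) ≡ eval m f · specialise G
  specialise-map-mul1 f []      = refl
  specialise-map-mul1 f (g ∷ G) = cong₂ _∷_ (eval-⊠ m f g) (specialise-map-mul1 f G)

  specialise-mul2 : ∀ F G → specialise (mul2 p F G) ≡ specialise F ⊠ specialise G
  specialise-mul2 []      G = refl
  specialise-mul2 (f ∷ F) G = begin
    specialise (add2 p (map (mul1 p f) G) ([] ∷ mul2 p F G))
      ≡⟨ specialise-add2 (map (mul1 p f) G) ([] ∷ mul2 p F G) ⟩
    specialise (map (mul1 p f) G) ⊞ (0# ∷ specialise (mul2 p F G))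
      ≡⟨ cong₂ (λ u v → u ⊞ (0# ∷ v)) (specialise-map-mul1 f G) (specialise-mul2 F G) ⟩
    eval m f · specialise G ⊞ (0# ∷ specialise F ⊠ specialise G)
      ∎
    where open ≡-Reasoning

  specialise-pow2 : ∀ F n → specialise (pow2 p F n) ≡ pow1 p (specialise F) n
  specialise-pow2 F zero    = cong (_∷ []) (trans (cong (1# +_) (zeroʳ m)) (+-identityʳ 1#))
  specialise-pow2 F (suc n) = trans (specialise-mul2 F (pow2 p F n)) (cong (specialise F ⊠_) (specialise-pow2 F n))

  specialise-constY : ∀ f → specialise (constY p f) ≡ f
  specialise-constY []      = refl
  specialise-constY (a ∷ f) = cong₂ _∷_ (trans (cong (a +_) (zeroʳ m)) (+-identityʳ a)) (specialise-constY f)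

  specialise-division : ∀ n R S T → _≈2_ p (XpXpow2 p n) (add2 p (mul2 p R S) T) →
                        pow1 p (xpx p) n ≈ specialise R ⊠ specialise S ⊞ specialise T
  specialise-division n R S T division = subst₂ _≈_
    (trans (specialise-pow2 (constY p (xpx p)) n) (cong (λ f → pow1 p f n) (specialise-constY (xpx p))))
    (trans (specialise-add2 (mul2 p R S) T) (cong (_⊞ specialise T) (specialise-mul2 R S)))
    (specialise-cong _ _ division)

  lineRoot : Fp p × Fp p → Fp p
  lineRoot (a , b) = m * a + - b

  eval-redeiFactor : ∀ c ab → eval c (specialise (redeiFactor p ab)) ≡ c + - lineRoot ab
  eval-redeiFactor c (a , b) = begin
    b + m * (- a + m * 0#) + c * (1# + m * 0# + c * 0#)
      ≡⟨ cong₂ (λ u v → b + m * u + c * v) (trans (cong (- a +_) (zeroʳ m)) (+-identityʳ (- a)))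
               (trans (cong₂ _+_ (trans (cong (1# +_) (zeroʳ m)) (+-identityʳ 1#)) (zeroʳ c)) (+-identityʳ 1#)) ⟩
    b + m * - a + c * 1#         ≡⟨ cong (b + m * - a +_) (*-identityʳ c) ⟩
    b + m * - a + c              ≡⟨ +-comm (b + m * - a) c ⟩
    c + (b + m * - a)            ≡⟨ cong (c +_) (+-comm b (m * - a)) ⟩
    c + (m * - a + b)            ≡⟨ cong (c +_) (cong₂ _+_ (-‿distribʳ-* m a) (⁻¹-involutive b)) ⟨
    c + (- (m * a) + - - b)      ≡⟨ cong (c +_) (⁻¹-∙-comm (m * a) (- b)) ⟩
    c + - (m * a + - b)          ∎
    where open ≡-Reasoning

  redei-vanishes : ∀ U c → VanishesToOrder c (multiplicity c (map lineRoot U)) (specialise (Redei p U))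
  redei-vanishes []       c = order0
  redei-vanishes (ab ∷ U) c =
    subst (VanishesToOrder c _) (sym (specialise-mul2 (redeiFactor p ab) (Redei p U)))
      (factor-times-rest (lineRoot ab ≟ c))
    where
    factor = specialise (redeiFactor p ab)
    rest   = specialise (Redei p U)
    vanishes-at-c : ℕ → Set
    vanishes-at-c k = VanishesToOrder c k (factor ⊠ rest)
    factor-times-rest : Dec (lineRoot ab ≡ c) → vanishes-at-c (multiplicity c (map lineRoot (ab ∷ U)))
    factor-times-rest (yes refl) = subst vanishes-at-c (sym (multiplicity-∷-≡ (map lineRoot U) refl))
      (vanishes-⊠ factor rest (root (trans (eval-redeiFactor c ab) (-‿inverseʳ c)) order0) (redei-vanishes U c))
    factor-times-rest (no root≢c) = subst vanishes-at-c (sym (multiplicity-∷-≢ (map lineRoot U) root≢c))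
      (vanishes-⊠ʳ factor rest (redei-vanishes U c))

  onLine? : ∀ k → Decidable (λ (uv : Fp p × Fp p) → proj₂ uv ≡ m * proj₁ uv + - k)
  onLine? k uv = proj₂ uv ≟ m * proj₁ uv + - k

  lineCount≡multiplicity : ∀ k U → lineCount p m k U ≡ multiplicity k (map lineRoot U)
  lineCount≡multiplicity k []            = refl
  lineCount≡multiplicity k ((a , b) ∷ U) = by-cases (b ≟ m * a + - k)
    where
    open ≡-Reasoning
    by-cases : Dec (b ≡ m * a + - k) → lineCount p m k ((a , b) ∷ U) ≡ multiplicity k (map lineRoot ((a , b) ∷ U))
    by-cases (yes on-line) = begin
      lineCount p m k ((a , b) ∷ U)                  ≡⟨ cong length (filter-accept (onLine? k) on-line) ⟩
      suc (lineCount p m k U)                        ≡⟨ cong suc (lineCount≡multiplicity k U) ⟩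
      suc (multiplicity k (map lineRoot U))          ≡⟨ multiplicity-∷-≡ (map lineRoot U) root≡k ⟨
      multiplicity k (map lineRoot ((a , b) ∷ U))    ∎
      where
      root≡k : lineRoot (a , b) ≡ k
      root≡k = trans (cong (λ z → m * a + - z) on-line) (x-[x-y]≡y (m * a) k)
    by-cases (no off-line) = begin
      lineCount p m k ((a , b) ∷ U)                  ≡⟨ cong length (filter-reject (onLine? k) off-line) ⟩
      lineCount p m k U                              ≡⟨ lineCount≡multiplicity k U ⟩
      multiplicity k (map lineRoot U)                ≡⟨ multiplicity-∷-≢ (map lineRoot U) root≢k ⟨
      multiplicity k (map lineRoot ((a , b) ∷ U))    ∎
      where
      root≢k : lineRoot (a , b) ≢ k
      root≢k root≡k = off-line (trans (sym (x-[x-y]≡y (m * a) b)) (cong (λ z → m * a + - z) root≡k))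

  not-rich⇒lineCount≤ : ∀ {n} k U → length U ℕ.≤ n ℕ.* p → ¬ RichLine p m k U →
                        lineCount p m k U ℕ.≤ n
  not-rich⇒lineCount≤ {n} k U |U|≤np not-rich =
    ℕ.<⇒≤pred (ℕ.*-cancelˡ-< p (lineCount p m k U) (suc n) (begin-strict
    p ℕ.* lineCount p m k U    <⟨ ℕ.≰⇒> not-rich ⟩
    length U ℕ.+ p             ≤⟨ ℕ.+-monoˡ-≤ p |U|≤np ⟩
    n ℕ.* p ℕ.+ p              ≡⟨ ℕ.+-comm (n ℕ.* p) p ⟩
    p ℕ.+ n ℕ.* p              ≡⟨ cong (p ℕ.+_) (ℕ.*-comm n p) ⟩
    p ℕ.+ p ℕ.* n              ≡⟨ ℕ.*-suc p n ⟨
    p ℕ.* suc n                ∎))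
    where open ℕ.≤-Reasoning

  not-rich⇒multiplicity≤ : ∀ {n} U → length U ℕ.≤ n ℕ.* p → ¬ RichDirection p U m →
                           ∀ c → multiplicity c (map lineRoot U) ℕ.≤ n
  not-rich⇒multiplicity≤ U |U|≤np not-rich c =
    subst (ℕ._≤ _) (lineCount≡multiplicity c U) (not-rich⇒lineCount≤ c U |U|≤np (not-rich ∘ (c ,_)))

open import Data.Nat using (_*_; _≤_)
open import Data.List.Relation.Unary.Unique.Propositional using (Unique)
open import Data.Product using (_×_)

proposition3p6 : (p : ℕ) {{_ : NonZero p}} → Prime p
    → (U : List (Fin p × Fin p)) → Unique U → U ≢ []
    → (n : ℕ) → 1 ≤ n → length U ≤ n * p
    → (m : Fin p) → ¬ RichDirection p U m
    → (S T : Poly2 p)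
    → _≈2_ p (XpXpow2 p n) (add2 p (mul2 p (Redei p U) S) T)
    → degX< p T (length U)
    → _≈1_ p (evalY p m (mul2 p (Redei p U) S)) (pow1 p (xpx p) n)
proposition3p6 p p-prime U _ _ n _ |U|≤np m not-rich S T division deg-T = coeff-≡ (begin
  specialise (mul2 p (Redei p U) S)   ≡⟨ specialise-mul2 (Redei p U) S ⟩
  r ⊠ s                               ≈⟨ ⊞-identityʳ (r ⊠ s) t≈0 ⟨
  r ⊠ s ⊞ t                           ≈⟨ specialise-division n (Redei p U) S T division ⟨
  pow1 p (xpx p) n                    ∎)
  where
  open Polynomial p
  open Fermat p
  open Specialisation p m
  open import Relation.Binary.Reasoning.Setoid ≈-setoid
  r = specialise (Redei p U)
  s = specialise S
  t = specialise T

  t-vanishes : ∀ c → VanishesToOrder c (multiplicity c (map lineRoot U)) t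
  t-vanishes c = vanishes-⊞-cancelˡ (r ⊠ s) t
    (vanishes-cong (specialise-division n (Redei p U) S T division)
      (vanishes-≤ (not-rich⇒multiplicity≤ U |U|≤np not-rich c) (vanishes-pow (xpx p) n (eval-xpx≡0 p-prime c))))
    (vanishes-⊠ˡ r s (redei-vanishes U c))

  t≈0 : t ≈ []
  t≈0 = vanishing-at-roots⇒≈[] p-prime (map lineRoot U) t
    (subst (Degree< t) (sym (length-map lineRoot U)) (specialise-degree< T (length U) deg-T)) t-vanishes
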